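{- Let $p$ be the L tromino. If $P$ is a $(p,2)$-prismatic polyomino with width $w$ and height $h$, then $|P|=13$ and $w\le 5$, $h\le5$.
   Context: Cells are the unit squares of the square lattice, indexed by integer coordinates $(x,y)$. A polyomino is a finite nonempty edge-connected set of cells; its size $|P|$ is its number of cells; its width (resp. height) is the number of columns (resp. rows) occupied by its cells; polyominoes are considered up to translation. The L tromino is $\{(0,0),(1,0),(0,1)\}$ (only this orientation). An $n$-coloring assigns each cell a color in $\{1,\dots,n\}$. An instance of a shape is a translate of it; an instance contained in a colored set is colored by restriction, and two instances have the same coloring if the colorings agree under the translation. A de Bruijn polyomino for $(p,n)$ is an $n$-colored polyomino containing exactly one instance of each of the $n^{|p|}$ distinct $n$-colorings of $p$; a $(p,n)$-prismatic polyomino is a de Bruijn polyomino for $(p,n)$ of minimum size. -}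

module Defs where

open import Data.Nat using (ℕ; _≤_)
open import Data.Integer as ℤ using (ℤ; +_)
open import Data.Fin using (Fin; zero; suc)
open import Data.Product using (_×_; _,_; proj₁; proj₂; ∃; ∃-syntax)
open import Data.Sum using (_⊎_)
open import Data.List using (List; length; map; deduplicate)
open import Data.List.Membership.Propositional using (_∈_)
open import Data.List.Relation.Unary.Unique.Propositional using (Unique)
open import Relation.Binary.PropositionalEquality using (_≡_)

Cell : Set
Cell = ℤ × ℤ

_⊕_ : Cell → Cell → Cell
(a , b) ⊕ (c , d) = (a ℤ.+ c , b ℤ.+ d)

Adj : Cell → Cell → Set
Adj a b = (b ≡ a ⊕ (+ 1 , + 0)) ⊎ (a ≡ b ⊕ (+ 1 , + 0))
        ⊎ (b ≡ a ⊕ (+ 0 , + 1)) ⊎ (a ≡ b ⊕ (+ 0 , + 1))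

data Reach (S : List Cell) : Cell → Cell → Set where
  here : ∀ {a} → Reach S a a
  step : ∀ {a b c} → Adj a b → b ∈ S → Reach S b c → Reach S a c

record ColoredPolyomino (n : ℕ) : Set where
  field
    cells     : List Cell
    unique    : Unique cells
    nonempty  : ∃[ c ] c ∈ cells
    connected : ∀ {a b} → a ∈ cells → b ∈ cells → Reach cells a b
    colour    : Cell → Fin n
open ColoredPolyomino public

size : ∀ {n} → ColoredPolyomino n → ℕ
size P = length (cells P)

width : ∀ {n} → ColoredPolyomino n → ℕ
width P = length (deduplicate ℤ._≟_ (map proj₁ (cells P)))

height : ∀ {n} → ColoredPolyomino n → ℕ
height P = length (deduplicate ℤ._≟_ (map proj₂ (cells P)))

LTromino : Fin 3 → Cell
LTromino zero = (+ 0 , + 0)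
LTromino (suc zero) = (+ 1 , + 0)
LTromino (suc (suc zero)) = (+ 0 , + 1)

-- t is (the translation vector of) an instance of the L tromino in P
-- whose induced coloring is c.
LInstance : ∀ {n} → ColoredPolyomino n → (Fin 3 → Fin n) → Cell → Set
LInstance P c t = ∀ i → ((t ⊕ LTromino i) ∈ cells P) × (colour P (t ⊕ LTromino i) ≡ c i)

DeBruijnL : ∀ {n} → ColoredPolyomino n → Set
DeBruijnL P = ∀ c → ∃[ t ] (LInstance P c t × (∀ t′ → LInstance P c t′ → t′ ≡ t))

PrismaticL : ∀ {n} → ColoredPolyomino n → Set
PrismaticL {n} P = DeBruijnL P × (∀ (Q : ColoredPolyomino n) → DeBruijnL Q → size P ≤ size Q)

-- Upper bound: an explicit de Bruijn polyomino with 13 cells. Lower bound: let T be the 8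
-- instance positions in a de Bruijn polyomino P, and consider in turn columns, rows and
-- antidiagonals. Each instance has two cells on a common line, and the first cell of every
-- line of P (lowest, resp. leftmost) is never the later of the two, so |P| ≥ 8 + #lines(P);
-- in particular w, h ≤ |P| − 8. The line just past the last line met by T is also a line of
-- P, so #lines(P) ≥ #lines(T) + 1. Hence if |P| ≤ 12, then T meets at most 3 columns, 3 rows
-- and 3 antidiagonals. Such a set has at most 7 points: a column holds at most 3 of them, and
-- two columns holding 3 coincide, since each has a cell in the lowest row and meets every
-- antidiagonal, which puts each weakly to the left of the other.
module Submission where

open import Data.Bool using (if_then_else_)
open import Data.Empty using (⊥-elim)
open import Data.Fin using (Fin; zero; suc)
import Data.Fin.Properties as Fin
open import Data.Integer as ℤ using (ℤ; +_; 1ℤ)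
import Data.Integer.Properties as ℤ
open import Data.Integer.Tactic.RingSolver using (solve-∀)
open import Data.List using (List; []; _∷_; length; map; filter; deduplicate; _++_; concatMap; cartesianProduct; allFin)
import Data.List.Extrema ℤ.≤-totalOrder as Extrema
import Data.List.Membership.DecPropositional as DecMembership
open import Data.List.Membership.Propositional using (_∈_; _∉_; lose)
open import Data.List.Membership.Propositional.Properties
  using ( ∈-map⁺; ∈-map⁻; ∈-filter⁺; ∈-filter⁻; ∈-deduplicate⁺; ∈-deduplicate⁻; ∈-++⁻; ∈-concatMap⁺
        ; ∈-cartesianProduct⁺; ∈-allFin)
open import Data.List.Properties
  using (length-removeAt′; length-++; length-map; length-deduplicate; filter-accept; filter-reject)
open import Data.List.Relation.Binary.Subset.Propositional using (_⊆_)
import Data.List.Relation.Unary.All as All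
open import Data.List.Relation.Unary.All using (All; []; _∷_)
import Data.List.Relation.Unary.All.Properties as All
open import Data.List.Relation.Unary.Any using (here; there; _─_)
open import Data.List.Relation.Unary.Unique.DecPropositional using (unique?)
open import Data.List.Relation.Unary.Unique.DecPropositional.Properties using (deduplicate-!)
open import Data.List.Relation.Unary.Unique.Propositional using (Unique; []; _∷_)
import Data.List.Relation.Unary.Unique.Propositional.Properties as Unique
open import Data.Maybe using (Maybe; just; nothing; from-just)
import Data.Maybe.Effectful as Maybe
open import Data.Nat as ℕ using (ℕ; zero; suc; _≤_; z≤n; s≤s)
open import Data.Nat.ListAction using (sum)
import Data.Nat.Properties as ℕ
open import Data.Nat.Tactic.RingSolver using () renaming (solve-∀ to ℕ-solve-∀)
open import Data.Product using (_×_; _,_; proj₁; proj₂; ∃-syntax)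
import Data.Product.Properties as ×
open import Data.Sum using (inj₁; inj₂)
open import Function using (_∘_)
open import Relation.Binary.Definitions using (DecidableEquality)
open import Relation.Binary.PropositionalEquality
open import Relation.Nullary using (Dec; does; yes; no; ¬?)
open import Relation.Nullary.Decidable using (_⊎-dec_; from-yes)

open import Defs
open import Algebra.Properties.AbelianGroup ℤ.+-0-abelianGroup using (∙-cancelˡ; ∙-cancelʳ)

open DecMembership ℤ._≟_ using (_∈?_)

module _ {A : Set} where

  ∈-─⁺ : ∀ {x z : A} {ys} (x∈ys : x ∈ ys) → z ∈ ys → z ≢ x → z ∈ (ys ─ x∈ys)
  ∈-─⁺ (here refl) (here refl) z≢x = ⊥-elim (z≢x refl)
  ∈-─⁺ (here refl) (there z∈ys) _ = z∈ys
  ∈-─⁺ (there x∈ys) (here refl) _ = here refl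
  ∈-─⁺ (there x∈ys) (there z∈ys) z≢x = there (∈-─⁺ x∈ys z∈ys z≢x)

  length-mono-⊆ : ∀ {xs ys : List A} → Unique xs → xs ⊆ ys → length xs ≤ length ys
  length-mono-⊆ {[]} _ _ = z≤n
  length-mono-⊆ {x ∷ xs} {ys} (x∉xs ∷ !xs) xs⊆ys = begin
    suc (length xs)          ≤⟨ s≤s (length-mono-⊆ !xs xs⊆ys─x) ⟩
    suc (length (ys ─ x∈ys)) ≡⟨ length-removeAt′ ys _ ⟨
    length ys                ∎
    where
    open ℕ.≤-Reasoning
    x∈ys = xs⊆ys (here refl)
    xs⊆ys─x : xs ⊆ (ys ─ x∈ys)
    xs⊆ys─x z∈xs = ∈-─⁺ x∈ys (xs⊆ys (there z∈xs)) (λ z≡x → All.lookup x∉xs z∈xs (sym z≡x))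

  map⁺-injectiveOn : ∀ {B : Set} {f : A → B} {xs} →
    (∀ {x y} → x ∈ xs → y ∈ xs → f x ≡ f y → x ≡ y) → Unique xs → Unique (map f xs)
  map⁺-injectiveOn {xs = []} _ [] = []
  map⁺-injectiveOn {xs = x ∷ xs} inj (x∉xs ∷ !xs) =
    All.map⁺ (All.tabulate λ y∈xs fx≡fy → All.lookup x∉xs y∈xs (inj (here refl) (there y∈xs) fx≡fy))
    ∷ map⁺-injectiveOn (λ x∈ y∈ → inj (there x∈) (there y∈)) !xs

  Unique-map⇒injectiveOn : ∀ {B : Set} {f : A → B} {xs x y} →
    Unique (map f xs) → x ∈ xs → y ∈ xs → f x ≡ f y → x ≡ y
  Unique-map⇒injectiveOn _ (here refl) (here refl) _ = refl
  Unique-map⇒injectiveOn {f = f} (fx∉ ∷ _) (here refl) (there y∈) fx≡fy =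
    ⊥-elim (All.lookup fx∉ (∈-map⁺ f y∈) fx≡fy)
  Unique-map⇒injectiveOn {f = f} (fy∉ ∷ _) (there x∈) (here refl) fx≡fy =
    ⊥-elim (All.lookup fy∉ (∈-map⁺ f x∈) (sym fx≡fy))
  Unique-map⇒injectiveOn (_ ∷ !xs) (there x∈) (there y∈) fx≡fy = Unique-map⇒injectiveOn !xs x∈ y∈ fx≡fy

  all-equal⇒length≤1 : ∀ {xs : List A} → Unique xs → (∀ {x y} → x ∈ xs → y ∈ xs → x ≡ y) →
    length xs ≤ 1
  all-equal⇒length≤1 {[]} _ _ = z≤n
  all-equal⇒length≤1 {_ ∷ []} _ _ = ℕ.≤-refl
  all-equal⇒length≤1 {_ ∷ _ ∷ _} ((x≢y ∷ _) ∷ _) equal =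
    ⊥-elim (x≢y (equal (here refl) (there (here refl))))

  length-concatMap : ∀ {B : Set} (f : A → List B) xs → length (concatMap f xs) ≡ sum (map (length ∘ f) xs)
  length-concatMap f [] = refl
  length-concatMap f (x ∷ xs) = trans (length-++ (f x)) (cong (length (f x) ℕ.+_) (length-concatMap f xs))

module _ {A : Set} (f : A → ℕ) (k : ℕ) (f≤1+k : ∀ x → f x ≤ suc k) where
  open ℕ.≤-Reasoning

  private
    exceeds? = λ x → suc k ℕ.≤? f x
    #exceeding = λ xs → length (filter exceeds? xs)

    suc-shift : ∀ a m e → suc a ℕ.+ (m ℕ.+ e) ≡ a ℕ.+ m ℕ.+ suc e
    suc-shift = ℕ-solve-∀

  sum≤-by-threshold : ∀ xs →
    sum (map f xs) ≤ length xs ℕ.* k ℕ.+ length (filter (λ x → suc k ℕ.≤? f x) xs)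
  sum≤-by-threshold [] = z≤n
  sum≤-by-threshold (x ∷ xs) with ih ← sum≤-by-threshold xs | exceeds? x
  ... | yes fx>k = begin
    f x ℕ.+ sum (map f xs)                        ≤⟨ ℕ.+-mono-≤ (f≤1+k x) ih ⟩
    suc k ℕ.+ (length xs ℕ.* k ℕ.+ #exceeding xs) ≡⟨ suc-shift k (length xs ℕ.* k) (#exceeding xs) ⟩
    k ℕ.+ length xs ℕ.* k ℕ.+ suc (#exceeding xs) ≡⟨ cong (λ ys → k ℕ.+ length xs ℕ.* k ℕ.+ length ys)
                                                           (filter-accept exceeds? fx>k) ⟨
    k ℕ.+ length xs ℕ.* k ℕ.+ #exceeding (x ∷ xs) ∎
  ... | no fx≯k = begin
    f x ℕ.+ sum (map f xs)                    ≤⟨ ℕ.+-mono-≤ (ℕ.≤-pred (ℕ.≰⇒> fx≯k)) ih ⟩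
    k ℕ.+ (length xs ℕ.* k ℕ.+ #exceeding xs) ≡⟨ ℕ.+-assoc k _ _ ⟨
    k ℕ.+ length xs ℕ.* k ℕ.+ #exceeding xs   ≡⟨ cong (λ ys → k ℕ.+ length xs ℕ.* k ℕ.+ length ys)
                                                       (filter-reject exceeds? fx≯k) ⟨
    k ℕ.+ length xs ℕ.* k ℕ.+ #exceeding (x ∷ xs) ∎

i<i+1 : ∀ i → i ℤ.< i ℤ.+ 1ℤ
i<i+1 i = ℤ.suc[i]≤j⇒i<j (ℤ.≤-reflexive (ℤ.+-comm 1ℤ i))

∃-minimum : ∀ {x xs} → x ∈ xs → ∃[ m ] m ∈ xs × All (m ℤ.≤_) xs
∃-minimum {x} {xs} x∈xs =
  Extrema.min x xs , Extrema.argmin-all (λ z → z) x∈xs (All.tabulate (λ z∈ → z∈)) , Extrema.min≤xs x xs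

∃-maximum : ∀ {x xs} → x ∈ xs → ∃[ m ] m ∈ xs × All (ℤ._≤ m) xs
∃-maximum {x} {xs} x∈xs =
  Extrema.max x xs , Extrema.argmax-all (λ z → z) x∈xs (All.tabulate (λ z∈ → z∈)) , Extrema.xs≤max x xs

card : List ℤ → ℕ
card xs = length (deduplicate ℤ._≟_ xs)

length≤card : ∀ {xs ys} → Unique xs → xs ⊆ ys → length xs ≤ card ys
length≤card !xs xs⊆ys = length-mono-⊆ !xs (∈-deduplicate⁺ ℤ._≟_ ∘ xs⊆ys)

card-mono : ∀ {xs ys} → xs ⊆ ys → card xs ≤ card ys
card-mono {xs} xs⊆ys = length≤card (deduplicate-! ℤ._≟_ xs) (xs⊆ys ∘ ∈-deduplicate⁻ ℤ._≟_ xs)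

card≤length : ∀ xs → card xs ≤ length xs
card≤length = length-deduplicate ℤ._≟_

card≤length⇒⊇ : ∀ {xs ys} → Unique xs → xs ⊆ ys → card ys ≤ length xs → ys ⊆ xs
card≤length⇒⊇ {xs} {ys} !xs xs⊆ys card≤ {y} y∈ys with y ∈? xs
... | yes y∈xs = y∈xs
... | no y∉xs = ⊥-elim (ℕ.<-irrefl refl (ℕ.≤-trans (length≤card !y∷xs y∷xs⊆ys) card≤))
  where
  !y∷xs : Unique (y ∷ xs)
  !y∷xs = All.tabulate (λ z∈xs y≡z → y∉xs (subst (_∈ xs) (sym y≡z) z∈xs)) ∷ !xs
  y∷xs⊆ys : y ∷ xs ⊆ ys
  y∷xs⊆ys (here refl) = y∈ys
  y∷xs⊆ys (there z∈xs) = xs⊆ys z∈xs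

suc-card≤card : ∀ {x xs ys} → x ∈ xs → xs ⊆ ys → (∀ {z} → z ∈ xs → z ℤ.+ 1ℤ ∈ ys) →
  suc (card xs) ≤ card ys
suc-card≤card {xs = xs} {ys} x∈xs xs⊆ys succ⊆ys with ∃-maximum x∈xs
... | m , m∈xs , xs≤m = length≤card !m+1∷xs m+1∷xs⊆ys
  where
  m+1∉xs : ∀ {z} → z ∈ deduplicate ℤ._≟_ xs → m ℤ.+ 1ℤ ≢ z
  m+1∉xs z∈ refl =
    ℤ.<-irrefl refl (ℤ.≤-<-trans (All.lookup xs≤m (∈-deduplicate⁻ ℤ._≟_ xs z∈)) (i<i+1 m))
  !m+1∷xs : Unique (m ℤ.+ 1ℤ ∷ deduplicate ℤ._≟_ xs)
  !m+1∷xs = All.tabulate m+1∉xs ∷ deduplicate-! ℤ._≟_ xs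
  m+1∷xs⊆ys : m ℤ.+ 1ℤ ∷ deduplicate ℤ._≟_ xs ⊆ ys
  m+1∷xs⊆ys (here refl) = succ⊆ys m∈xs
  m+1∷xs⊆ys (there z∈) = xs⊆ys (∈-deduplicate⁻ ℤ._≟_ xs z∈)

module _ {A : Set} (_≟_ : DecidableEquality A) (key rank : A → ℤ) where
  open DecMembership _≟_ using () renaming (_∈?_ to _∈ᴬ?_)

  ∃-rank-minimal : ∀ {S s} → s ∈ S →
    ∃[ m ] m ∈ S × key m ≡ key s × (∀ {b} → b ∈ S → key b ≡ key s → rank m ℤ.≤ rank b)
  ∃-rank-minimal {S} {s} s∈S = m , proj₁ m∈S×km≡ks , proj₂ m∈S×km≡ks , minimal
    where
    sameKey? = λ a → key a ℤ.≟ key s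
    class = filter sameKey? S
    m = Extrema.argmin rank s class
    m∈S×km≡ks : m ∈ S × key m ≡ key s
    m∈S×km≡ks = ∈-filter⁻ sameKey? {xs = S}
      (Extrema.argmin-all rank (∈-filter⁺ sameKey? s∈S refl) (All.tabulate (λ b∈ → b∈)))
    minimal : ∀ {b} → b ∈ S → key b ≡ key s → rank m ℤ.≤ rank b
    minimal b∈S kb≡ks = All.lookup (Extrema.f[argmin]≤f[xs] s class) (∈-filter⁺ sameKey? b∈S kb≡ks)

  -- The rank-minimal element of every key class lies in S but outside N.
  length+card≤length : ∀ {S N} → Unique S → Unique N → N ⊆ S →
    (∀ {a} → a ∈ N → ∃[ b ] b ∈ S × key b ≡ key a × rank b ℤ.< rank a) →
    length N ℕ.+ card (map key S) ≤ length S
  length+card≤length {S} {N} !S !N N⊆S descent = begin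
    length N ℕ.+ card (map key S)    ≤⟨ ℕ.+-monoʳ-≤ (length N) (card-mono keysS⊆keysR) ⟩
    length N ℕ.+ card (map key R)    ≤⟨ ℕ.+-monoʳ-≤ (length N) (card≤length (map key R)) ⟩
    length N ℕ.+ length (map key R)  ≡⟨ cong (length N ℕ.+_) (length-map key R) ⟩
    length N ℕ.+ length R            ≡⟨ length-++ N ⟨
    length (N ++ R)                  ≤⟨ length-mono-⊆ !N++R N++R⊆S ⟩
    length S                         ∎
    where
    open ℕ.≤-Reasoning
    ∉N? = λ a → ¬? (a ∈ᴬ? N)
    R = filter ∉N? S
    !N++R : Unique (N ++ R)
    !N++R = Unique.++⁺ !N (Unique.filter⁺ ∉N? !S)
      (λ (a∈N , a∈R) → proj₂ (∈-filter⁻ ∉N? {xs = S} a∈R) a∈N)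
    N++R⊆S : N ++ R ⊆ S
    N++R⊆S a∈ with ∈-++⁻ N a∈
    ... | inj₁ a∈N = N⊆S a∈N
    ... | inj₂ a∈R = proj₁ (∈-filter⁻ ∉N? {xs = S} a∈R)
    keysS⊆keysR : map key S ⊆ map key R
    keysS⊆keysR k∈ with ∈-map⁻ key k∈
    ... | s , s∈S , refl with ∃-rank-minimal s∈S
    ... | m , m∈S , km≡ks , minimal = subst (_∈ map key R) km≡ks (∈-map⁺ key (∈-filter⁺ ∉N? m∈S m∉N))
      where
      m∉N : m ∉ N
      m∉N m∈N with descent m∈N
      ... | b , b∈S , kb≡km , rb<rm = ℤ.<-irrefl refl (ℤ.≤-<-trans (minimal b∈S (trans kb≡km km≡ks)) rb<rm)

_≟ᶜ_ : DecidableEquality Cell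
_≟ᶜ_ = ×.≡-dec ℤ._≟_ ℤ._≟_

open DecMembership _≟ᶜ_ using () renaming (_∈?_ to _∈ᶜ?_)

antidiagonal : Cell → ℤ
antidiagonal (x , y) = x ℤ.+ y

+-≤-cancel : ∀ {a b y y′} → a ℤ.+ y ≡ b ℤ.+ y′ → y ℤ.≤ y′ → b ℤ.≤ a
+-≤-cancel {a} {b} e y≤y′ with b ℤ.≤? a
... | yes b≤a = b≤a
... | no b≰a = ⊥-elim (ℤ.<-irrefl e (ℤ.+-mono-<-≤ (ℤ.≰⇒> b≰a) y≤y′))

module Columns {Q : List Cell} (!Q : Unique Q) where

  column : ℤ → List Cell
  column a = filter (λ q → proj₁ q ℤ.≟ a) Q

  column⁻ : ∀ {a q} → q ∈ column a → q ∈ Q × proj₁ q ≡ a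
  column⁻ {a} = ∈-filter⁻ (λ q → proj₁ q ℤ.≟ a) {xs = Q}

  module _ {line : Cell → ℤ}
           (line-injective : ∀ {a q q′} → q ∈ column a → q′ ∈ column a → line q ≡ line q′ → q ≡ q′) where

    unique-lines : ∀ a → Unique (map line (column a))
    unique-lines a = map⁺-injectiveOn line-injective (Unique.filter⁺ _ !Q)

    lines⊆ : ∀ a → map line (column a) ⊆ map line Q
    lines⊆ a l∈ with ∈-map⁻ line l∈
    ... | q , q∈ , refl = ∈-map⁺ line (proj₁ (column⁻ q∈))

    length-column≤card : ∀ a → length (column a) ≤ card (map line Q)
    length-column≤card a = subst (_≤ _) (length-map line (column a)) (length≤card (unique-lines a) (lines⊆ a))

    full-column-meets-all : ∀ {a} → card (map line Q) ≤ length (column a) → map line Q ⊆ map line (column a)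
    full-column-meets-all {a} full = card≤length⇒⊇ (unique-lines a) (lines⊆ a)
      (subst (card (map line Q) ≤_) (sym (length-map line (column a))) full)

  y-injective : ∀ {a q q′} → q ∈ column a → q′ ∈ column a → proj₂ q ≡ proj₂ q′ → q ≡ q′
  y-injective q∈ q′∈ y≡y′ = cong₂ _,_ (trans (proj₂ (column⁻ q∈)) (sym (proj₂ (column⁻ q′∈)))) y≡y′

  antidiagonal-injective : ∀ {a q q′} → q ∈ column a → q′ ∈ column a →
    antidiagonal q ≡ antidiagonal q′ → q ≡ q′
  antidiagonal-injective {a} q∈ q′∈ e with proj₂ (column⁻ q∈) | proj₂ (column⁻ q′∈)
  ... | refl | refl = y-injective q∈ q′∈ (∙-cancelˡ a _ _ e)

  -- The lowest cell (a , y₀) of a column a meeting every row lies on an antidiagonal that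
  -- column b meets at some height y′ ≥ y₀, so b + y′ = a + y₀ forces b ≤ a.
  full-columns-ordered : ∀ {a b q} → q ∈ Q →
    card (map proj₂ Q) ≤ length (column a) → card (map antidiagonal Q) ≤ length (column b) → b ℤ.≤ a
  full-columns-ordered q∈Q rows≤ antidiagonals≤
    with ∃-minimum (∈-map⁺ proj₂ q∈Q)
  ... | y₀ , y₀∈ys , y₀≤
    with ∈-map⁻ proj₂ (full-column-meets-all y-injective rows≤ y₀∈ys)
  ... | q₁ , q₁∈ , y₀≡y₁
    with ∈-map⁻ antidiagonal (full-column-meets-all antidiagonal-injective antidiagonals≤
                               (∈-map⁺ antidiagonal (proj₁ (column⁻ q₁∈))))
  ... | q₂ , q₂∈ , d₁≡d₂
    with column⁻ q₁∈ | column⁻ q₂∈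
  ... | _ , refl | q₂∈Q , refl =
    +-≤-cancel d₁≡d₂ (subst (ℤ._≤ proj₂ q₂) y₀≡y₁ (All.lookup y₀≤ (∈-map⁺ proj₂ q₂∈Q)))

few-lines⇒length≤ : ∀ k {Q} → Unique Q →
  card (map proj₁ Q) ≤ suc k → card (map proj₂ Q) ≤ suc k → card (map antidiagonal Q) ≤ suc k →
  length Q ≤ suc k ℕ.* k ℕ.+ 1
few-lines⇒length≤ k {Q} !Q columns≤ rows≤ antidiagonals≤ = begin
  length Q                                     ≤⟨ length-mono-⊆ !Q Q⊆columns ⟩
  length (concatMap column xs)                 ≡⟨ length-concatMap column xs ⟩
  sum (map (length ∘ column) xs)               ≤⟨ sum≤-by-threshold (length ∘ column) k column≤ xs ⟩
  length xs ℕ.* k ℕ.+ length (filter full? xs) ≤⟨ ℕ.+-mono-≤ (ℕ.*-monoˡ-≤ k columns≤) at-most-one-full ⟩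
  suc k ℕ.* k ℕ.+ 1                            ∎
  where
  open ℕ.≤-Reasoning
  open Columns !Q
  xs = deduplicate ℤ._≟_ (map proj₁ Q)
  full? = λ a → suc k ℕ.≤? length (column a)
  Q⊆columns : Q ⊆ concatMap column xs
  Q⊆columns q∈Q =
    ∈-concatMap⁺ column (lose (∈-deduplicate⁺ ℤ._≟_ (∈-map⁺ proj₁ q∈Q)) (∈-filter⁺ _ q∈Q refl))
  column≤ : ∀ a → length (column a) ≤ suc k
  column≤ a = ℕ.≤-trans (length-column≤card y-injective a) rows≤
  full-columns-equal : ∀ {a b} → a ∈ filter full? xs → b ∈ filter full? xs → a ≡ b
  full-columns-equal a∈ b∈ with ∈-filter⁻ full? {xs = xs} a∈ | ∈-filter⁻ full? {xs = xs} b∈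
  ... | a∈xs , a-full | _ , b-full with ∈-map⁻ proj₁ (∈-deduplicate⁻ ℤ._≟_ _ a∈xs)
  ... | q , q∈Q , _ = ℤ.≤-antisym
    (full-columns-ordered q∈Q (ℕ.≤-trans rows≤ b-full) (ℕ.≤-trans antidiagonals≤ a-full))
    (full-columns-ordered q∈Q (ℕ.≤-trans rows≤ a-full) (ℕ.≤-trans antidiagonals≤ b-full))
  at-most-one-full : length (filter full? xs) ≤ 1
  at-most-one-full =
    all-equal⇒length≤1 (Unique.filter⁺ full? (deduplicate-! ℤ._≟_ (map proj₁ Q))) full-columns-equal

⊕-identityʳ : ∀ t → t ⊕ (+ 0 , + 0) ≡ t
⊕-identityʳ (x , y) = cong₂ _,_ (ℤ.+-identityʳ x) (ℤ.+-identityʳ y)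

⊕-cancelʳ : ∀ v {t t′} → t ⊕ v ≡ t′ ⊕ v → t ≡ t′
⊕-cancelʳ (a , b) e = cong₂ _,_ (∙-cancelʳ a _ _ (cong proj₁ e)) (∙-cancelʳ b _ _ (cong proj₂ e))

LPosition : List Cell → Cell → Set
LPosition S t = ∀ i → t ⊕ LTromino i ∈ S

LPosition⇒∈ : ∀ {S t} → LPosition S t → t ∈ S
LPosition⇒∈ {S} {t} t-pos = subst (_∈ S) (⊕-identityʳ t) (t-pos zero)

record LineFamily : Set where
  field
    line rank : Cell → ℤ
    lower upper next : Fin 3
    same-line : ∀ t → line (t ⊕ LTromino lower) ≡ line (t ⊕ LTromino upper)
    lower<upper : ∀ t → rank (t ⊕ LTromino lower) ℤ.< rank (t ⊕ LTromino upper)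
    next-line : ∀ t → line (t ⊕ LTromino next) ≡ line t ℤ.+ 1ℤ

i+0<i+1 : ∀ i → i ℤ.+ + 0 ℤ.< i ℤ.+ 1ℤ
i+0<i+1 i = ℤ.+-monoʳ-< i (ℤ.+<+ (s≤s z≤n))

columns : LineFamily
columns = record
  { line = proj₁ ; rank = proj₂ ; lower = zero ; upper = suc (suc zero) ; next = suc zero
  ; same-line = λ _ → refl ; lower<upper = λ t → i+0<i+1 (proj₂ t) ; next-line = λ _ → refl }

rows : LineFamily
rows = record
  { line = proj₂ ; rank = proj₁ ; lower = zero ; upper = suc zero ; next = suc (suc zero)
  ; same-line = λ _ → refl ; lower<upper = λ t → i+0<i+1 (proj₁ t) ; next-line = λ _ → refl }

antidiagonal-e₂≡e₁ : ∀ x y → (x ℤ.+ + 0) ℤ.+ (y ℤ.+ 1ℤ) ≡ (x ℤ.+ 1ℤ) ℤ.+ (y ℤ.+ + 0)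
antidiagonal-e₂≡e₁ = solve-∀

antidiagonal-e₁≡suc : ∀ x y → (x ℤ.+ 1ℤ) ℤ.+ (y ℤ.+ + 0) ≡ (x ℤ.+ y) ℤ.+ 1ℤ
antidiagonal-e₁≡suc = solve-∀

antidiagonals : LineFamily
antidiagonals = record
  { line = antidiagonal ; rank = proj₁ ; lower = suc (suc zero) ; upper = suc zero ; next = suc zero
  ; same-line = λ (x , y) → antidiagonal-e₂≡e₁ x y
  ; lower<upper = λ t → i+0<i+1 (proj₁ t)
  ; next-line = λ (x , y) → antidiagonal-e₁≡suc x y }

module _ (F : LineFamily) {S T : List Cell} (!S : Unique S) (!T : Unique T)
         (T-pos : ∀ {t} → t ∈ T → LPosition S t) where
  open LineFamily F

  length+lines≤length : length T ℕ.+ card (map line S) ≤ length S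
  length+lines≤length = subst (λ m → m ℕ.+ card (map line S) ≤ length S) (length-map _ T)
    (length+card≤length _≟ᶜ_ line rank !S (Unique.map⁺ (⊕-cancelʳ _) !T) uppers⊆S descent)
    where
    uppers⊆S : map (_⊕ LTromino upper) T ⊆ S
    uppers⊆S u∈ with ∈-map⁻ _ u∈
    ... | t , t∈T , refl = T-pos t∈T upper
    descent : ∀ {u} → u ∈ map (_⊕ LTromino upper) T → ∃[ b ] b ∈ S × line b ≡ line u × rank b ℤ.< rank u
    descent u∈ with ∈-map⁻ _ u∈
    ... | t , t∈T , refl = t ⊕ LTromino lower , T-pos t∈T lower , same-line t , lower<upper t

  suc-lines≤lines : ∀ {t} → t ∈ T → suc (card (map line T)) ≤ card (map line S)
  suc-lines≤lines t∈T = suc-card≤card (∈-map⁺ line t∈T) lines⊆ next-lines⊆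
    where
    lines⊆ : map line T ⊆ map line S
    lines⊆ l∈ with ∈-map⁻ line l∈
    ... | t , t∈T , refl = ∈-map⁺ line (LPosition⇒∈ (T-pos t∈T))
    next-lines⊆ : ∀ {l} → l ∈ map line T → l ℤ.+ 1ℤ ∈ map line S
    next-lines⊆ l∈ with ∈-map⁻ line l∈
    ... | t , t∈T , refl = subst (_∈ map line S) (next-line t) (∈-map⁺ line (T-pos t∈T next))

  length+suc-lines≤length : ∀ {t} → t ∈ T → length T ℕ.+ suc (card (map line T)) ≤ length S
  length+suc-lines≤length t∈T =
    ℕ.≤-trans (ℕ.+-monoʳ-≤ (length T) (suc-lines≤lines t∈T)) length+lines≤length

L-positions+5≤length : ∀ {S T} → Unique S → Unique T → (∀ {t} → t ∈ T → LPosition S t) →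
  8 ≤ length T → length T ℕ.+ 5 ≤ length S
L-positions+5≤length {T = []} _ _ _ ()
L-positions+5≤length {S} {T@(_ ∷ _)} !S !T T-pos 8≤T with length T ℕ.+ 5 ℕ.≤? length S
... | yes enough = enough
... | no short = ⊥-elim (ℕ.<-irrefl refl (ℕ.≤-trans 8≤T
        (few-lines⇒length≤ 2 !T (at-most-3 columns) (at-most-3 rows) (at-most-3 antidiagonals))))
  where
  at-most-3 : (F : LineFamily) → card (map (LineFamily.line F) T) ≤ 3
  at-most-3 F = ℕ.≤-pred (ℕ.≤-pred (ℕ.+-cancelˡ-< (length T) _ 5
                  (ℕ.≤-<-trans (length+suc-lines≤length F !S !T T-pos (here refl)) (ℕ.≰⇒> short))))

-- Colourings of the L tromino, tabulated so that they have decidable equality.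
Triple : ℕ → Set
Triple n = Fin n × Fin n × Fin n

_≟ᵗ_ : ∀ {n} → DecidableEquality (Triple n)
_≟ᵗ_ = ×.≡-dec Fin._≟_ (×.≡-dec Fin._≟_ Fin._≟_)

triples : ∀ n → List (Triple n)
triples n = cartesianProduct (allFin n) (cartesianProduct (allFin n) (allFin n))

∈-triples : ∀ {n} (c : Triple n) → c ∈ triples n
∈-triples (a , b , c) = ∈-cartesianProduct⁺ (∈-allFin a) (∈-cartesianProduct⁺ (∈-allFin b) (∈-allFin c))

unique-triples : ∀ n → Unique (triples n)
unique-triples n =
  Unique.cartesianProduct⁺ (Unique.allFin⁺ n) (Unique.cartesianProduct⁺ (Unique.allFin⁺ n) (Unique.allFin⁺ n))

tabulate₃ : ∀ {n} → (Fin 3 → Fin n) → Triple n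
tabulate₃ c = c zero , c (suc zero) , c (suc (suc zero))

lookup₃ : ∀ {n} → Triple n → Fin 3 → Fin n
lookup₃ (a , b , c) zero = a
lookup₃ (a , b , c) (suc zero) = b
lookup₃ (a , b , c) (suc (suc zero)) = c

tabulate₃-cong : ∀ {n} {c c′ : Fin 3 → Fin n} → (∀ i → c i ≡ c′ i) → tabulate₃ c ≡ tabulate₃ c′
tabulate₃-cong c≗c′ = cong₂ _,_ (c≗c′ zero) (cong₂ _,_ (c≗c′ (suc zero)) (c≗c′ (suc (suc zero))))

tabulate₃-injective : ∀ {n} (c c′ : Fin 3 → Fin n) → tabulate₃ c ≡ tabulate₃ c′ → ∀ i → c i ≡ c′ i
tabulate₃-injective _ _ e zero = cong proj₁ e
tabulate₃-injective _ _ e (suc zero) = cong (proj₁ ∘ proj₂) e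
tabulate₃-injective _ _ e (suc (suc zero)) = cong (proj₂ ∘ proj₂) e

colouringAt : ∀ {n} → ColoredPolyomino n → Cell → Fin 3 → Fin n
colouringAt P t i = colour P (t ⊕ LTromino i)

module DeBruijnPositions {n} (P : ColoredPolyomino n) (deBruijn : DeBruijnL P) where

  position : Triple n → Cell
  position c = proj₁ (deBruijn (lookup₃ c))

  position-instance : ∀ c → LInstance P (lookup₃ c) (position c)
  position-instance c = proj₁ (proj₂ (deBruijn (lookup₃ c)))

  position-injective : ∀ {c c′} → position c ≡ position c′ → c ≡ c′
  position-injective {c} {c′} e = tabulate₃-cong λ i → begin
    lookup₃ c i                ≡⟨ proj₂ (position-instance c i) ⟨
    colouringAt P (position c) i  ≡⟨ cong (λ t → colouringAt P t i) e ⟩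
    colouringAt P (position c′) i ≡⟨ proj₂ (position-instance c′ i) ⟩
    lookup₃ c′ i               ∎
    where open ≡-Reasoning

  positions : List Cell
  positions = map position (triples n)

  unique-positions : Unique positions
  unique-positions = Unique.map⁺ position-injective (unique-triples n)

  positions-are-L : ∀ {t} → t ∈ positions → LPosition (cells P) t
  positions-are-L t∈ with ∈-map⁻ position t∈
  ... | c , _ , refl = λ i → proj₁ (position-instance c i)

LPositions : List Cell → List Cell
LPositions S = filter (λ t → Fin.all? (λ i → t ⊕ LTromino i ∈ᶜ? S)) S

code : ∀ {n} → ColoredPolyomino n → Cell → Triple n
code P t = tabulate₃ (colouringAt P t)

codes-bijective⇒deBruijn : ∀ {n} (P : ColoredPolyomino n) →
  Unique (map (code P) (LPositions (cells P))) → triples n ⊆ map (code P) (LPositions (cells P)) → DeBruijnL P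
codes-bijective⇒deBruijn P !codes triples⊆codes c
  with ∈-map⁻ (code P) (triples⊆codes (∈-triples (tabulate₃ c)))
... | t , t∈positions , c≡code-t = t , t-instance , only-instance
  where
  LPosition? = λ t → Fin.all? (λ i → t ⊕ LTromino i ∈ᶜ? cells P)
  t-instance : LInstance P c t
  t-instance i = proj₂ (∈-filter⁻ LPosition? {xs = cells P} t∈positions) i
               , sym (tabulate₃-injective c (colouringAt P t) c≡code-t i)
  only-instance : ∀ t′ → LInstance P c t′ → t′ ≡ t
  only-instance t′ t′-instance = Unique-map⇒injectiveOn !codes t′∈positions t∈positions
    (trans (tabulate₃-cong (proj₂ ∘ t′-instance)) c≡code-t)
    where
    t′∈positions = ∈-filter⁺ LPosition? (LPosition⇒∈ (proj₁ ∘ t′-instance)) (proj₁ ∘ t′-instance)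

Reach-trans : ∀ {S a b c} → Reach S a b → Reach S b c → Reach S a c
Reach-trans here r = r
Reach-trans (step adj b∈S r) r′ = step adj b∈S (Reach-trans r r′)

connected-via-hub : ∀ {S} h → All (Reach S h) S → All (λ a → Reach S a h) S →
  ∀ {a b} → a ∈ S → b ∈ S → Reach S a b
connected-via-hub h from-h to-h a∈S b∈S = Reach-trans (All.lookup to-h a∈S) (All.lookup from-h b∈S)

adj? : ∀ a b → Dec (Adj a b)
adj? a b = (b ≟ᶜ (a ⊕ (+ 1 , + 0))) ⊎-dec (a ≟ᶜ (b ⊕ (+ 1 , + 0)))
    ⊎-dec (b ≟ᶜ (a ⊕ (+ 0 , + 1))) ⊎-dec (a ≟ᶜ (b ⊕ (+ 0 , + 1)))

stepTowards : Cell → Cell → Cell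
stepTowards (x , y) (x′ , y′) with x ℤ.<? x′ | x′ ℤ.<? x | y ℤ.<? y′
... | yes _ | _     | _     = x ℤ.+ 1ℤ , y
... | no _  | yes _ | _     = x ℤ.- 1ℤ , y
... | no _  | no _  | yes _ = x , y ℤ.+ 1ℤ
... | no _  | no _  | no _  = x , y ℤ.- 1ℤ

greedyPath : ∀ S → ℕ → ∀ a b → Maybe (Reach S a b)
greedyPath S fuel a b with a ≟ᶜ b
... | yes refl = just here
greedyPath S zero a b | no _ = nothing
greedyPath S (suc fuel) a b | no _
  with adj? a (stepTowards a b) | stepTowards a b ∈ᶜ? S | greedyPath S fuel (stepTowards a b) b
... | yes adj | yes a′∈S | just path = just (step adj a′∈S path)
... | _       | _        | _         = nothing

greedyPathsFrom : ∀ S → ℕ → ∀ h → Maybe (All (Reach S h) S)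
greedyPathsFrom S fuel h = All.sequenceA _ Maybe.applicative (All.tabulate {xs = S} λ {b} _ → greedyPath S fuel h b)

greedyPathsTo : ∀ S → ℕ → ∀ h → Maybe (All (λ a → Reach S a h) S)
greedyPathsTo S fuel h = All.sequenceA _ Maybe.applicative (All.tabulate {xs = S} λ {a} _ → greedyPath S fuel a h)

-- Colours of the example, top row first:
--   0 1
--   1 1 0
--   0 0 1 0
--   0 0 1 1
exampleCells : List Cell
exampleCells =
  (+ 0 , + 0) ∷ (+ 0 , + 1) ∷ (+ 0 , + 2) ∷ (+ 0 , + 3) ∷
  (+ 1 , + 0) ∷ (+ 1 , + 1) ∷ (+ 1 , + 2) ∷ (+ 1 , + 3) ∷
  (+ 2 , + 0) ∷ (+ 2 , + 1) ∷ (+ 2 , + 2) ∷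
  (+ 3 , + 0) ∷ (+ 3 , + 1) ∷ []

exampleOnes : List Cell
exampleOnes = (+ 0 , + 2) ∷ (+ 1 , + 2) ∷ (+ 1 , + 3) ∷ (+ 2 , + 0) ∷ (+ 2 , + 1) ∷ (+ 3 , + 0) ∷ []

example : ColoredPolyomino 2
example = record
  { cells = exampleCells
  ; unique = from-yes (unique? _≟ᶜ_ exampleCells)
  ; nonempty = _ , here refl
  ; connected = connected-via-hub (+ 0 , + 0) (from-just (greedyPathsFrom exampleCells 6 (+ 0 , + 0)))
                                              (from-just (greedyPathsTo exampleCells 6 (+ 0 , + 0)))
  ; colour = λ c → if does (c ∈ᶜ? exampleOnes) then suc zero else zero
  }

example-deBruijn : DeBruijnL example
example-deBruijn = codes-bijective⇒deBruijn example
  (from-yes (unique? _≟ᵗ_ codes))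
  (All.lookup (from-yes (All.all? (λ c → DecMembership._∈?_ _≟ᵗ_ c codes) (triples 2))))
  where
  codes = map (code example) (LPositions exampleCells)

theorem7p5 : (P : ColoredPolyomino 2) → PrismaticL P →
    (size P ≡ 13) × (width P ≤ 5) × (height P ≤ 5)
theorem7p5 P (deBruijn , minimal) = ℕ.≤-antisym size≤13 13≤size , lines≤5 columns , lines≤5 rows
  where
  open DeBruijnPositions P deBruijn
  size≤13 : size P ≤ 13
  size≤13 = minimal example example-deBruijn
  13≤size : 13 ≤ size P
  13≤size = L-positions+5≤length (unique P) unique-positions positions-are-L ℕ.≤-refl
  lines≤5 : (F : LineFamily) → card (map (LineFamily.line F) (cells P)) ≤ 5
  lines≤5 F = ℕ.+-cancelˡ-≤ 8 _ 5
    (ℕ.≤-trans (length+lines≤length F (unique P) unique-positions positions-are-L) size≤13)
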